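{- Let $\pi=a_1a_2\cdots a_n\in\mathfrak{S}_n$ be 231-avoiding (there do not exist $i<j<k$ with $a_k<a_i<a_j$). Set $a_{n+1}=\infty$ and, for $1\le i\le n$, let $c_i$ be the positive integer such that $a_{c_i+i}$ is the first element to the right of $a_i$ with $a_{c_i+i}>a_i$, i.e. $c_i=\min\{j>i: a_j>a_i\}-i$. Then $$F(\Lambda_\pi,q)=\prod_{i=1}^n [c_i].$$
   Context: $\mathfrak{S}_n$ is the symmetric group on $\{1,\dots,n\}$, permutations in one-line notation, products composed right-to-left. Length $\ell(\pi)=\#\{i<j:a_i>a_j\}$. With $s_i=(i,i+1)$, the weak order is generated by covers $\pi\lessdot\sigma$ when $\sigma=\pi s_i$ and $\ell(\sigma)>\ell(\pi)$. $F(\Lambda_\pi,q)=\sum_{u\in[\mathrm{id},\pi]}q^{\ell(u)}$, the sum over the weak-order interval from the identity to $\pi$. $[c]=1+q+\cdots+q^{c-1}$. -}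

module Defs where

open import Data.Nat using (ℕ; zero; suc; _+_; _*_; _∸_; _<ᵇ_; _≡ᵇ_)
open import Data.Nat.ListAction using (sum)
open import Data.Bool using (Bool; true; false; if_then_else_)
open import Data.Fin using (Fin; toℕ) renaming (_<_ to _<ᶠ_)
open import Data.Fin.Properties using () renaming (_≟_ to _≟ᶠ_)
open import Data.Vec using (Vec; lookup; tabulate; allFin; toList)
open import Data.List using (List; []; _∷_; map; upTo; length; foldr) renaming (allFin to allFinL)
open import Data.Product using (Σ; _×_; _,_; ∃)
open import Relation.Nullary using (¬_; does)
open import Relation.Binary.PropositionalEquality using (_≡_)
open import Relation.Binary.Construct.Closure.ReflexiveTransitive using (Star)
open import Function.Definitions using (Injective)

-- Permutations of {1..n} in one-line notation: a vector a_1 … a_n of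
-- values in Fin n (values shifted down by 1, which does not affect any
-- comparison).
Word : ℕ → Set
Word n = Vec (Fin n) n

IsPerm : ∀ {n} → Word n → Set
IsPerm {n} w = Injective _≡_ _≡_ (lookup w)

idPerm : ∀ n → Word n
idPerm n = allFin n

count : ∀ {A : Set} → (A → Bool) → List A → ℕ
count p [] = 0
count p (x ∷ xs) = (if p x then 1 else 0) + count p xs

len : ∀ {n} → Word n → ℕ
len {n} w = count (λ ij → isInv (Data.Product.proj₁ ij) (Data.Product.proj₂ ij)) pairs
  where
  open import Data.List using (concatMap)
  pairs : List (Fin n × Fin n)
  pairs = concatMap (λ i → map (λ j → (i , j)) (allFinL n)) (allFinL n)
  isInv : Fin n → Fin n → Bool
  isInv i j = (toℕ i <ᵇ toℕ j) Data.Bool.∧ (toℕ (lookup w j) <ᵇ toℕ (lookup w i))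

-- swap the entries at positions i and j (right multiplication by the
-- transposition (i j) in one-line notation)
swapPos : ∀ {n} → Word n → Fin n → Fin n → Word n
swapPos w i j = tabulate λ k →
  if does (k ≟ᶠ i) then lookup w j else
  if does (k ≟ᶠ j) then lookup w i else lookup w k

-- cover relation of the (right) weak order: v = u s_i with ℓ(v) > ℓ(u),
-- where s_i swaps adjacent positions i and i+1.
data Cover {n : ℕ} (u : Word n) : Word n → Set where
  cover : (i j : Fin n) → toℕ j ≡ suc (toℕ i) →
          len u Data.Nat.< len (swapPos u i j) → Cover u (swapPos u i j)

_≤W_ : ∀ {n} → Word n → Word n → Set
u ≤W v = Star Cover u v

InInterval : ∀ {n} → Word n → Word n → Set
InInterval {n} π u = (idPerm n ≤W u) × (u ≤W π)

Avoids231 : ∀ {n} → Word n → Set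
Avoids231 {n} w = (i j k : Fin n) → i <ᶠ j → j <ᶠ k →
  ¬ ((lookup w k <ᶠ lookup w i) × (lookup w i <ᶠ lookup w j))

-- c_i = min{ j > i : a_j > a_i } − i, with a_{n+1} = ∞
nextGreater : ℕ → List ℕ → ℕ
nextGreater x [] = 1
nextGreater x (y ∷ ys) = if x <ᵇ y then 1 else suc (nextGreater x ys)

cList : List ℕ → List ℕ
cList [] = []
cList (a ∷ as) = nextGreater a as ∷ cList as

cs : ∀ {n} → Word n → List ℕ
cs w = cList (map toℕ (toList w))

-- polynomials in q with ℕ coefficients, as coefficient functions
Poly : Set
Poly = ℕ → ℕ

onePoly : Poly
onePoly k = if k ≡ᵇ 0 then 1 else 0

qint : ℕ → Poly
qint c k = if k <ᵇ c then 1 else 0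

_⊛_ : Poly → Poly → Poly
(f ⊛ g) k = sum (map (λ i → f i * g (k ∸ i)) (upTo (suc k)))

prodQInt : List ℕ → Poly
prodQInt = foldr (λ c p → qint c ⊛ p) onePoly

genPoly : ∀ {n} → List (Word n) → Poly
genPoly L k = count (λ u → len u ≡ᵇ k) L

module Submission where

-- Permutations are handled as lists of distinct naturals.  For π = a ∷ l
-- let c = nextGreater a l; `interval π` inserts a into every member of
-- `interval l` at each position 0, …, c−1.  If π avoids 231, the entries of
-- l below a form a prefix S, c = |S| + 1, and every member of `interval l`
-- again starts with |S| entries below a (`lowPrefix-interval`).  Hence the
-- members lie below π in the weak order (`reachesTop`), form a down-set
-- containing π (`closedDown`), and lie above the increasing list
-- (`reachedFromSorted`): they are exactly the interval [id, π].  They are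
-- distinct (`interval-unique`), and inserting a at position c−1−d adds d
-- inversions, so each step contributes the factor [c] to the generating
-- polynomial (`interval-weightPoly`).

open import Defs
open import Data.Bool using (Bool; true; false; if_then_else_; T; _∧_)
open import Data.Fin using (Fin; zero; suc; toℕ; fromℕ<) renaming (_<_ to _<ᶠ_)
open import Data.Fin.Properties using (toℕ-fromℕ<; fromℕ<-toℕ; toℕ-injective; toℕ<n)
  renaming (_≟_ to _≟ᶠ_; suc-injective to Fin-suc-injective)
open import Data.List using (List; []; _∷_; _++_; map; concatMap; length; downFrom; upTo; applyUpTo)
  renaming (tabulate to tabulateL; allFin to allFinL)
open import Data.List.Membership.Propositional using (_∈_; _∉_; find; lose)
open import Data.List.Membership.Propositional.Properties
  using (∈-concatMap⁻; ∈-concatMap⁺; ∈-map⁻; ∈-map⁺; ∈-downFrom⁻; ∈-downFrom⁺; ∈-upTo⁻; ∈-∃++; ∈-++⁻; ∈-++⁺ˡ; ∈-++⁺ʳ)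
open import Data.List.Properties using (∷-injective; length-++-≤ˡ; map-cong; map-cong-local; map-tabulate; reverse-downFrom; upTo-∷ʳ)
open import Data.List.Relation.Binary.Permutation.Propositional as Perm using (_↭_; ↭-refl; ↭-sym; ↭-trans; prep; swap)
open import Data.List.Relation.Binary.Permutation.Propositional.Properties
  using (All-resp-↭; ∈-resp-↭; ↭-length; ↭-reverse; map⁺; shift; drop-mid; ++-comm)
open import Data.List.Relation.Unary.All as All using (All; []; _∷_)
import Data.List.Relation.Unary.All.Properties as All
open import Data.List.Relation.Unary.AllPairs using (AllPairs; []; _∷_)
open import Data.List.Relation.Unary.AllPairs.Properties using (applyUpTo⁺₁)
open import Data.List.Relation.Unary.Any using (here; there)
open import Data.List.Relation.Unary.Unique.Propositional using (Unique)
import Data.List.Relation.Unary.Unique.Propositional.Properties as Unique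
open import Data.Nat.Base
open import Data.Nat.ListAction using (sum)
open import Data.Nat.ListAction.Properties using (sum-↭)
open import Data.Nat.Properties
open import Algebra.Properties.CommutativeSemigroup +-commutativeSemigroup using (interchange; x∙yz≈y∙xz)
open import Data.List.Membership.DecPropositional _≟_ using (_∈?_)
open import Data.Product using (Σ; _×_; _,_; proj₁; proj₂)
open import Data.Sum using (inj₁; inj₂)
open import Data.Vec using (Vec; []; _∷_; lookup; toList; tabulate)
open import Data.Vec.Properties using (lookup∘tabulate)
open import Function.Bundles using (_⇔_; mk⇔)
open import Function.Definitions using (Injective)
open import Relation.Binary using (tri<; tri≈; tri>)
open import Relation.Binary.Construct.Closure.ReflexiveTransitive using (Star; ε; _◅_; _◅◅_; gmap)
open import Relation.Binary.PropositionalEquality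
open import Relation.Nullary using (¬_; contradiction; yes; no; does)

<ᵇ-true : ∀ {m n} → m < n → (m <ᵇ n) ≡ true
<ᵇ-true {m} {n} m<n with m <ᵇ n | <⇒<ᵇ m<n
... | true | _ = refl

<ᵇ-false : ∀ {m n} → ¬ m < n → (m <ᵇ n) ≡ false
<ᵇ-false {m} {n} m≮n with m <ᵇ n in eq
... | false = refl
... | true = contradiction (<ᵇ⇒< m n (subst T (sym eq) _)) m≮n

≡ᵇ-true : ∀ {m n} → m ≡ n → (m ≡ᵇ n) ≡ true
≡ᵇ-true {m} {n} m≡n with m ≡ᵇ n | ≡⇒≡ᵇ m n m≡n
... | true | _ = refl

≡ᵇ-false : ∀ {m n} → m ≢ n → (m ≡ᵇ n) ≡ false
≡ᵇ-false {m} {n} m≢n with m ≡ᵇ n in eq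
... | false = refl
... | true = contradiction (≡ᵇ⇒≡ m n (subst T (sym eq) _)) m≢n

indicator : Bool → ℕ
indicator b = if b then 1 else 0

count-++ : ∀ {A : Set} (p : A → Bool) xs ys → count p (xs ++ ys) ≡ count p xs + count p ys
count-++ p [] ys = refl
count-++ p (x ∷ xs) ys =
  trans (cong (indicator (p x) +_) (count-++ p xs ys)) (sym (+-assoc (indicator (p x)) _ _))

count-map : ∀ {A B : Set} (p : B → Bool) (f : A → B) xs → count p (map f xs) ≡ count (λ x → p (f x)) xs
count-map p f [] = refl
count-map p f (x ∷ xs) = cong (indicator (p (f x)) +_) (count-map p f xs)

count-cong : ∀ {A : Set} (p q : A → Bool) {xs} → All (λ x → p x ≡ q x) xs → count p xs ≡ count q xs
count-cong p q [] = refl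
count-cong p q (px≡qx ∷ eqs) = cong₂ (λ b n → indicator b + n) px≡qx (count-cong p q eqs)

count-↭ : ∀ {A : Set} (p : A → Bool) {xs ys} → xs ↭ ys → count p xs ≡ count p ys
count-↭ p Perm.refl = refl
count-↭ p (prep x xs↭ys) = cong (indicator (p x) +_) (count-↭ p xs↭ys)
count-↭ p {x ∷ y ∷ xs} {_ ∷ _ ∷ ys} (swap _ _ xs↭ys) = begin
  indicator (p x) + (indicator (p y) + count p xs)
    ≡⟨ cong (λ n → indicator (p x) + (indicator (p y) + n)) (count-↭ p xs↭ys) ⟩
  indicator (p x) + (indicator (p y) + count p ys)
    ≡⟨ x∙yz≈y∙xz (indicator (p x)) (indicator (p y)) (count p ys) ⟩
  indicator (p y) + (indicator (p x) + count p ys) ∎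
  where open ≡-Reasoning
count-↭ p (Perm.trans xs↭ys ys↭zs) = trans (count-↭ p xs↭ys) (count-↭ p ys↭zs)

count-all-true : ∀ {A : Set} (p : A → Bool) {xs} → All (λ x → p x ≡ true) xs → count p xs ≡ length xs
count-all-true p [] = refl
count-all-true p (px ∷ pxs) rewrite px = cong suc (count-all-true p pxs)

count-all-false : ∀ {A : Set} (p : A → Bool) {xs} → All (λ x → p x ≡ false) xs → count p xs ≡ 0
count-all-false p [] = refl
count-all-false p (px ∷ pxs) rewrite px = count-all-false p pxs

count-as-sum : ∀ {A : Set} (p : A → Bool) xs → count p xs ≡ sum (map (λ x → indicator (p x)) xs)
count-as-sum p [] = refl
count-as-sum p (x ∷ xs) = cong (indicator (p x) +_) (count-as-sum p xs)

sum-cong : ∀ {A : Set} (f g : A → ℕ) {xs} → All (λ x → f x ≡ g x) xs → sum (map f xs) ≡ sum (map g xs)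
sum-cong f g eqs = cong sum (map-cong-local eqs)

sum-zero : ∀ {A : Set} (f : A → ℕ) xs → (∀ x → f x ≡ 0) → sum (map f xs) ≡ 0
sum-zero f [] f≡0 = refl
sum-zero f (x ∷ xs) f≡0 rewrite f≡0 x = sum-zero f xs f≡0

sum-+ : ∀ {A : Set} (f g : A → ℕ) xs → sum (map (λ x → f x + g x) xs) ≡ sum (map f xs) + sum (map g xs)
sum-+ f g [] = refl
sum-+ f g (x ∷ xs) rewrite sum-+ f g xs = interchange (f x) (g x) (sum (map f xs)) (sum (map g xs))

sum-select : ∀ (h : ℕ → ℕ) t m →
  sum (map (λ j → h j * indicator (t ≡ᵇ j)) (downFrom m)) ≡ (if t <ᵇ m then h t else 0)
sum-select h t zero = refl
sum-select h t (suc m) with <-cmp t m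
... | tri< t<m t≢m _ rewrite ≡ᵇ-false t≢m | *-zeroʳ (h m) | sum-select h t m
                           | <ᵇ-true t<m | <ᵇ-true (m<n⇒m<1+n t<m) = refl
... | tri≈ _ refl _ rewrite ≡ᵇ-true (refl {x = t}) | *-identityʳ (h t) | sum-select h t t
                           | <ᵇ-false (n≮n t) | <ᵇ-true (n<1+n t) = +-identityʳ (h t)
... | tri> _ t≢m m<t rewrite ≡ᵇ-false t≢m | *-zeroʳ (h m) | sum-select h t m
                           | <ᵇ-false (<⇒≯ m<t) | <ᵇ-false (≤⇒≯ m<t) = refl

≡ᵇ-resp-⇔ : ∀ {m n m' n'} → (m ≡ n → m' ≡ n') → (m' ≡ n' → m ≡ n) → (m ≡ᵇ n) ≡ (m' ≡ᵇ n')
≡ᵇ-resp-⇔ {m} {n} to from with m ≟ n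
... | yes m≡n = trans (≡ᵇ-true m≡n) (sym (≡ᵇ-true (to m≡n)))
... | no m≢n = trans (≡ᵇ-false m≢n) (sym (≡ᵇ-false (λ e → m≢n (from e))))

monomial : ℕ → Poly
monomial x j = indicator (x ≡ᵇ j)

weightPoly : ∀ {A : Set} → (A → ℕ) → List A → Poly
weightPoly e W j = count (λ w → e w ≡ᵇ j) W

⊛-congʳ : ∀ (f g h : Poly) → (∀ j → g j ≡ h j) → ∀ k → (f ⊛ g) k ≡ (f ⊛ h) k
⊛-congʳ f g h g≗h k = cong sum (map-cong (λ i → cong (f i *_) (g≗h (k ∸ i))) (upTo (suc k)))

⊛-zeroʳ : ∀ (f : Poly) k → (f ⊛ (λ _ → 0)) k ≡ 0
⊛-zeroʳ f k = sum-zero (λ i → f i * 0) (upTo (suc k)) (λ i → *-zeroʳ (f i))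

⊛-distribˡ-+ : ∀ (f g h : Poly) k → (f ⊛ (λ j → g j + h j)) k ≡ (f ⊛ g) k + (f ⊛ h) k
⊛-distribˡ-+ f g h k = begin
  sum (map (λ i → f i * (g (k ∸ i) + h (k ∸ i))) (upTo (suc k)))
    ≡⟨ cong sum (map-cong (λ i → *-distribˡ-+ (f i) (g (k ∸ i)) (h (k ∸ i))) (upTo (suc k))) ⟩
  sum (map (λ i → f i * g (k ∸ i) + f i * h (k ∸ i)) (upTo (suc k)))
    ≡⟨ sum-+ (λ i → f i * g (k ∸ i)) (λ i → f i * h (k ∸ i)) (upTo (suc k)) ⟩
  (f ⊛ g) k + (f ⊛ h) k ∎
  where open ≡-Reasoning

qint-shift : ∀ c x k → count (λ d → (d + x) ≡ᵇ k) (downFrom c) ≡ (qint c ⊛ monomial x) k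
qint-shift c x k with x ≤? k
... | no x≰k = trans no-exponent (sym no-coefficient)
  where
  no-exponent : count (λ d → (d + x) ≡ᵇ k) (downFrom c) ≡ 0
  no-exponent = count-all-false _ {downFrom c} (All.tabulate λ {d} _ →
    ≡ᵇ-false (λ d+x≡k → x≰k (subst (x ≤_) d+x≡k (m≤n+m x d))))
  no-coefficient : (qint c ⊛ monomial x) k ≡ 0
  no-coefficient = sum-zero _ (upTo (suc k)) λ i →
    trans (cong (λ b → qint c i * indicator b) (≡ᵇ-false (λ x≡k∸i → x≰k (subst (_≤ k) (sym x≡k∸i) (m∸n≤m k i)))))
          (*-zeroʳ (qint c i))
... | yes x≤k = trans lhs (sym rhs)
  where
  open ≡-Reasoning
  t : ℕ
  t = k ∸ x
  lhs : count (λ d → (d + x) ≡ᵇ k) (downFrom c) ≡ qint c t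
  lhs = begin
    count (λ d → (d + x) ≡ᵇ k) (downFrom c)
      ≡⟨ count-as-sum _ (downFrom c) ⟩
    sum (map (λ d → indicator ((d + x) ≡ᵇ k)) (downFrom c))
      ≡⟨ sum-cong _ _ {downFrom c} (All.tabulate λ {d} _ → trans
           (cong indicator (≡ᵇ-resp-⇔ (λ e → trans (cong (_∸ x) (sym e)) (m+n∸n≡m d x))
                                      (λ e → trans (cong (_+ x) (sym e)) (m∸n+n≡m x≤k))))
           (sym (*-identityˡ _))) ⟩
    sum (map (λ d → 1 * indicator (t ≡ᵇ d)) (downFrom c))
      ≡⟨ sum-select (λ _ → 1) t c ⟩
    qint c t ∎
  rhs : (qint c ⊛ monomial x) k ≡ qint c t
  rhs = begin
    sum (map (λ i → qint c i * indicator (x ≡ᵇ (k ∸ i))) (upTo (suc k)))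
      ≡⟨ sum-cong _ _ {upTo (suc k)} (All.tabulate λ {i} i∈ → cong (λ b → qint c i * indicator b)
           (≡ᵇ-resp-⇔ (λ e → trans (cong (k ∸_) e) (m∸[m∸n]≡n (≤-pred (∈-upTo⁻ i∈))))
                      (λ e → trans (sym (m∸[m∸n]≡n x≤k)) (cong (k ∸_) e)))) ⟩
    sum (map (λ i → qint c i * indicator (t ≡ᵇ i)) (upTo (suc k)))
      ≡⟨ sum-↭ (map⁺ _ upTo↭downFrom) ⟩
    sum (map (λ i → qint c i * indicator (t ≡ᵇ i)) (downFrom (suc k)))
      ≡⟨ sum-select (qint c) t (suc k) ⟩
    (if t <ᵇ suc k then qint c t else 0)
      ≡⟨ cong (λ b → if b then qint c t else 0) (<ᵇ-true (s≤s (m∸n≤m k x))) ⟩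
    qint c t ∎
    where
    upTo↭downFrom : upTo (suc k) ↭ downFrom (suc k)
    upTo↭downFrom = subst (_↭ downFrom (suc k)) (reverse-downFrom (suc k)) (↭-reverse (downFrom (suc k)))

weightPoly-concatMap : ∀ {A B : Set} (e : B → ℕ) (e' : A → ℕ) (F : A → List B) (f : Poly) W →
  (∀ {w} → w ∈ W → ∀ k → weightPoly e (F w) k ≡ (f ⊛ monomial (e' w)) k) →
  ∀ k → weightPoly e (concatMap F W) k ≡ (f ⊛ weightPoly e' W) k
weightPoly-concatMap e e' F f [] hyp k = sym (⊛-zeroʳ f k)
weightPoly-concatMap e e' F f (w ∷ W) hyp k = begin
  weightPoly e (F w ++ concatMap F W) k
    ≡⟨ count-++ (λ v → e v ≡ᵇ k) (F w) (concatMap F W) ⟩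
  weightPoly e (F w) k + weightPoly e (concatMap F W) k
    ≡⟨ cong₂ _+_ (hyp (here refl) k) (weightPoly-concatMap e e' F f W (λ w∈ → hyp (there w∈)) k) ⟩
  (f ⊛ monomial (e' w)) k + (f ⊛ weightPoly e' W) k
    ≡⟨ sym (⊛-distribˡ-+ f (monomial (e' w)) (weightPoly e' W) k) ⟩
  (f ⊛ weightPoly e' (w ∷ W)) k ∎
  where open ≡-Reasoning

inversions : List ℕ → ℕ
inversions [] = 0
inversions (x ∷ l) = count (_<ᵇ x) l + inversions l

-- `insertAt p a w` puts a in front of the p-th entry of w (at the end if p ≥ |w|).
insertAt : ℕ → ℕ → List ℕ → List ℕ
insertAt zero a w = a ∷ w
insertAt (suc p) a [] = a ∷ []
insertAt (suc p) a (x ∷ w) = x ∷ insertAt p a w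

insertAt-↭ : ∀ p a w → insertAt p a w ↭ a ∷ w
insertAt-↭ zero a w = ↭-refl
insertAt-↭ (suc p) a [] = ↭-refl
insertAt-↭ (suc p) a (x ∷ w) = ↭-trans (prep x (insertAt-↭ p a w)) (swap x a ↭-refl)

length-insertAt : ∀ p a w → length (insertAt p a w) ≡ suc (length w)
length-insertAt zero a w = refl
length-insertAt (suc p) a [] = refl
length-insertAt (suc p) a (x ∷ w) = cong suc (length-insertAt p a w)

All-insertAt : ∀ {P : ℕ → Set} p a w → P a → All P w → All P (insertAt p a w)
All-insertAt zero a w pa pw = pa ∷ pw
All-insertAt (suc p) a [] pa pw = pa ∷ []
All-insertAt (suc p) a (x ∷ w) pa (px ∷ pw) = px ∷ All-insertAt p a w pa pw

insertAt-++ : ∀ p a S B → p ≤ length S → insertAt p a (S ++ B) ≡ insertAt p a S ++ B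
insertAt-++ zero a S B _ = refl
insertAt-++ (suc p) a (x ∷ S) B (s≤s p≤|S|) = cong (x ∷_) (insertAt-++ p a S B p≤|S|)

insertAt-end : ∀ a S B → insertAt (length S) a S ++ B ≡ S ++ a ∷ B
insertAt-end a [] B = refl
insertAt-end a (x ∷ S) B = cong (x ∷_) (insertAt-end a S B)

insertAt-injective : ∀ a p p' w w' → a ∉ w → a ∉ w' → p ≤ length w → p' ≤ length w' →
  insertAt p a w ≡ insertAt p' a w' → p ≡ p' × w ≡ w'
insertAt-injective a zero zero w w' _ _ _ _ refl = refl , refl
insertAt-injective a zero (suc p') w (x ∷ w') _ a∉w' _ _ refl = contradiction (here refl) a∉w'
insertAt-injective a (suc p) zero (x ∷ w) w' a∉w _ _ _ refl = contradiction (here refl) a∉w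
insertAt-injective a (suc p) (suc p') (x ∷ w) (y ∷ w') a∉w a∉w' (s≤s p≤) (s≤s p'≤) eq
  with ∷-injective eq
... | refl , eq' with insertAt-injective a p p' w w' (λ m → a∉w (there m)) (λ m → a∉w' (there m)) p≤ p'≤ eq'
... | refl , refl = refl , refl

-- Inserting a at position p ≤ |S| into S ++ B, where S lies below a and B
-- does not, creates exactly |S| − p new inversions (with the entries of S
-- that end up behind a).
inversions-insertAt : ∀ a p S B → All (_< a) S → p ≤ length S → All (λ x → ¬ x < a) B →
  inversions (insertAt p a (S ++ B)) ≡ (length S ∸ p) + inversions (S ++ B)
inversions-insertAt a zero S B S<a _ B≮a = cong (_+ inversions (S ++ B)) (begin
  count (_<ᵇ a) (S ++ B)              ≡⟨ count-++ (_<ᵇ a) S B ⟩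
  count (_<ᵇ a) S + count (_<ᵇ a) B   ≡⟨ cong₂ _+_ (count-all-true (_<ᵇ a) (All.map <ᵇ-true S<a))
                                                   (count-all-false (_<ᵇ a) (All.map <ᵇ-false B≮a)) ⟩
  length S + 0                        ≡⟨ +-identityʳ (length S) ⟩
  length S                            ∎)
  where open ≡-Reasoning
inversions-insertAt a (suc p) (x ∷ S) B (x<a ∷ S<a) (s≤s p≤|S|) B≮a = begin
  count (_<ᵇ x) (insertAt p a (S ++ B)) + inversions (insertAt p a (S ++ B))
    ≡⟨ cong₂ _+_ (count-↭ (_<ᵇ x) (insertAt-↭ p a (S ++ B))) (inversions-insertAt a p S B S<a p≤|S| B≮a) ⟩
  (if a <ᵇ x then 1 else 0) + count (_<ᵇ x) (S ++ B) + ((length S ∸ p) + inversions (S ++ B))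
    ≡⟨ cong (λ b → (if b then 1 else 0) + count (_<ᵇ x) (S ++ B) + ((length S ∸ p) + inversions (S ++ B)))
            (<ᵇ-false (<⇒≯ x<a)) ⟩
  count (_<ᵇ x) (S ++ B) + ((length S ∸ p) + inversions (S ++ B))
    ≡⟨ x∙yz≈y∙xz (count (_<ᵇ x) (S ++ B)) (length S ∸ p) (inversions (S ++ B)) ⟩
  (length S ∸ p) + (count (_<ᵇ x) (S ++ B) + inversions (S ++ B)) ∎
  where open ≡-Reasoning

data _⋖_ : List ℕ → List ℕ → Set where
  here  : ∀ {x y r} → x < y → (x ∷ y ∷ r) ⋖ (y ∷ x ∷ r)
  there : ∀ {z l l'} → l ⋖ l' → (z ∷ l) ⋖ (z ∷ l')

_≼_ : List ℕ → List ℕ → Set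
_≼_ = Star _⋖_

⋖-↭ : ∀ {l l'} → l ⋖ l' → l ↭ l'
⋖-↭ (here _) = swap _ _ ↭-refl
⋖-↭ (there l⋖l') = prep _ (⋖-↭ l⋖l')

⋖-inversions : ∀ {l l'} → l ⋖ l' → inversions l < inversions l'
⋖-inversions (here {x} {y} {r} x<y) rewrite <ᵇ-true x<y | <ᵇ-false (<⇒≯ x<y) =
  s≤s (≤-reflexive (x∙yz≈y∙xz (count (_<ᵇ x) r) (count (_<ᵇ y) r) (inversions r)))
⋖-inversions (there {z} {l} {l'} l⋖l') rewrite count-↭ (_<ᵇ z) (⋖-↭ l⋖l') =
  +-monoʳ-< (count (_<ᵇ z) l') (⋖-inversions l⋖l')

≼-cons : ∀ z {l l'} → l ≼ l' → (z ∷ l) ≼ (z ∷ l')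
≼-cons z = gmap (z ∷_) there

raiseToFront : ∀ a p S B → All (_< a) S → p ≤ length S → (insertAt p a S ++ B) ≼ (a ∷ S ++ B)
raiseToFront a zero S B _ _ = ε
raiseToFront a (suc p) (x ∷ S) B (x<a ∷ S<a) (s≤s p≤|S|) =
  ≼-cons x (raiseToFront a p S B S<a p≤|S|) ◅◅ (here x<a ◅ ε)

nextGreater-split : ∀ a S B → All (_< a) S → All (a <_) B → nextGreater a (S ++ B) ≡ suc (length S)
nextGreater-split a [] [] _ _ = refl
nextGreater-split a [] (b ∷ B) _ (a<b ∷ _) rewrite <ᵇ-true a<b = refl
nextGreater-split a (x ∷ S) B (x<a ∷ S<a) a<B rewrite <ᵇ-false (<⇒≯ x<a) =
  cong suc (nextGreater-split a S B S<a a<B)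

nextGreater-≤-prefix : ∀ b a S B → b < a → All (λ x → ¬ x < a) B → nextGreater b (S ++ B) ≤ suc (length S)
nextGreater-≤-prefix b a [] [] _ _ = ≤-refl
nextGreater-≤-prefix b a [] (x ∷ B) b<a (x≮a ∷ _) rewrite <ᵇ-true (<-≤-trans b<a (≮⇒≥ x≮a)) = ≤-refl
nextGreater-≤-prefix b a (y ∷ S) B b<a B≮a with b <ᵇ y
... | true = s≤s z≤n
... | false = s≤s (nextGreater-≤-prefix b a S B b<a B≮a)

nextGreater-pos : ∀ a l → 0 < nextGreater a l
nextGreater-pos a [] = s≤s z≤n
nextGreater-pos a (y ∷ l) with a <ᵇ y
... | true = s≤s z≤n
... | false = s≤s z≤n

nextGreater-≤ : ∀ a l → nextGreater a l ≤ suc (length l)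
nextGreater-≤ a [] = ≤-refl
nextGreater-≤ a (y ∷ l) with a <ᵇ y
... | true = s≤s z≤n
... | false = s≤s (nextGreater-≤ a l)

insertions : ℕ → ℕ → List ℕ → List (List ℕ)
insertions c a w = map (λ d → insertAt (c ∸ suc d) a w) (downFrom c)

interval : List ℕ → List (List ℕ)
interval [] = [] ∷ []
interval (a ∷ l) = concatMap (insertions (nextGreater a l) a) (interval l)

data Inserted (a c : ℕ) (W : List (List ℕ)) : List ℕ → Set where
  inserted : ∀ {w} p → w ∈ W → p < c → Inserted a c W (insertAt p a w)

∸-suc-involutive : ∀ {c p} → p < c → c ∸ suc (c ∸ suc p) ≡ p
∸-suc-involutive {suc c} (s≤s p≤c) = m∸[m∸n]≡n p≤c

∸-suc-< : ∀ {c} d → 0 < c → c ∸ suc d < c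
∸-suc-< {suc c} d _ = s≤s (m∸n≤m c d)

interval-∈⁻ : ∀ a l {w} → w ∈ interval (a ∷ l) → Inserted a (nextGreater a l) (interval l) w
interval-∈⁻ a l w∈ with find (∈-concatMap⁻ (insertions (nextGreater a l) a) {xs = interval l} w∈)
... | w' , w'∈ , w∈ins with ∈-map⁻ (λ d → insertAt (nextGreater a l ∸ suc d) a w') w∈ins
... | d , _ , refl = inserted _ w'∈ (∸-suc-< d (nextGreater-pos a l))

interval-∈⁺ : ∀ a l {w p} → w ∈ interval l → p < nextGreater a l → insertAt p a w ∈ interval (a ∷ l)
interval-∈⁺ a l {w} {p} w∈ p<c =
  ∈-concatMap⁺ (insertions c a) {xs = interval l}
    (lose w∈ (subst (λ q → insertAt q a w ∈ insertions c a w) (∸-suc-involutive p<c)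
      (∈-map⁺ (λ d → insertAt (c ∸ suc d) a w) (∈-downFrom⁺ (∸-suc-< p (≤-<-trans z≤n p<c))))))
  where
  c : ℕ
  c = nextGreater a l

interval-↭ : ∀ l {w} → w ∈ interval l → w ↭ l
interval-↭ [] (here refl) = ↭-refl
interval-↭ (a ∷ l) w∈ with interval-∈⁻ a l w∈
... | inserted p w'∈ _ = ↭-trans (insertAt-↭ p a _) (prep a (interval-↭ l w'∈))

interval-self : ∀ l → l ∈ interval l
interval-self [] = here refl
interval-self (a ∷ l) = interval-∈⁺ a l (interval-self l) (nextGreater-pos a l)

data SplitAt (a : ℕ) : List ℕ → Set where
  split : ∀ {S B} → All (_< a) S → All (a <_) B → SplitAt a (S ++ B)

-- 231-avoidance for lists of distinct entries: every entry splits the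
-- list of entries to its right.
data Avoids231ˡ : List ℕ → Set where
  []  : Avoids231ˡ []
  _∷_ : ∀ {a l} → SplitAt a l → Avoids231ˡ l → Avoids231ˡ (a ∷ l)

data LowPrefix (a m : ℕ) : List ℕ → Set where
  lowPrefix : ∀ {S B} → length S ≡ m → All (_< a) S → All (λ x → ¬ x < a) B → LowPrefix a m (S ++ B)

-- The low prefix of l survives in every member of `interval l`: the entries
-- below a are only rearranged among themselves.
lowPrefix-interval : ∀ {a} S B {w} → All (_< a) S → All (λ x → ¬ x < a) B →
  w ∈ interval (S ++ B) → LowPrefix a (length S) w
lowPrefix-interval [] B [] B≮a w∈ =
  lowPrefix {S = []} refl [] (All-resp-↭ (↭-sym (interval-↭ B w∈)) B≮a)
lowPrefix-interval {a} (b ∷ S) B (b<a ∷ S<a) B≮a w∈ with interval-∈⁻ b (S ++ B) w∈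
... | inserted p w'∈ p<c with lowPrefix-interval S B S<a B≮a w'∈
... | lowPrefix {S'} {B'} |S'|≡|S| S'<a B'≮a =
  subst (LowPrefix a (suc (length S))) (sym (insertAt-++ p b S' B' p≤|S'|))
    (lowPrefix (trans (length-insertAt p b S') (cong suc |S'|≡|S|)) (All-insertAt p b S' b<a S'<a) B'≮a)
  where
  p≤|S'| : p ≤ length S'
  p≤|S'| = ≤-pred (≤-trans p<c (subst (λ n → nextGreater b (S ++ B) ≤ suc n) (sym |S'|≡|S|)
                                      (nextGreater-≤-prefix b a S B b<a B≮a)))

insertPosition-≤ : ∀ {a S B p} (S' : List ℕ) → All (_< a) S → All (a <_) B → length S' ≡ length S →
  p < nextGreater a (S ++ B) → p ≤ length S'
insertPosition-≤ {a} {S} {B} {p} S' S<a a<B |S'|≡|S| p<c =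
  ≤-pred (subst (p <_) (trans (nextGreater-split a S B S<a a<B) (cong suc (sym |S'|≡|S|))) p<c)

-- Every member of the interval lies below π in the weak order: a is moved
-- to the front of the low prefix, and the rest is handled recursively.
reachesTop : ∀ {π w} → Avoids231ˡ π → w ∈ interval π → w ≼ π
reachesTop [] (here refl) = ε
reachesTop {a ∷ _} (split {S} {B} S<a a<B ∷ av) w∈ with interval-∈⁻ a (S ++ B) w∈
... | inserted p w'∈ p<c with lowPrefix-interval S B S<a (All.map <⇒≯ a<B) w'∈
... | lowPrefix {S'} {B'} |S'|≡|S| S'<a _ =
  subst (_≼ (a ∷ S ++ B)) (sym (insertAt-++ p a S' B' p≤|S'|))
    (raiseToFront a p S' B' S'<a p≤|S'| ◅◅ ≼-cons a (reachesTop av w'∈))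
  where
  p≤|S'| : p ≤ length S'
  p≤|S'| = insertPosition-≤ S' S<a a<B |S'|≡|S| p<c

-- The three ways a step u ⋖ insertAt p a w can arise: the swap happens
-- inside w, or a is exchanged with its left neighbour x (then a < x), or
-- with its right neighbour x (then x < a and u has a one place further right).
data StepInto (a p : ℕ) (w : List ℕ) : List ℕ → Set where
  inside    : ∀ {u} → u ⋖ w → StepInto a p w (insertAt p a u)
  fromLeft  : ∀ {u} pre x post → w ≡ pre ++ x ∷ post → suc (length pre) ≡ p → a < x → StepInto a p w u
  fromRight : ∀ pre x post → w ≡ pre ++ x ∷ post → length pre ≡ p → x < a →
              StepInto a p w (insertAt (suc p) a w)

stepInto-cons : ∀ {a p w u} z → StepInto a p w u → StepInto a (suc p) (z ∷ w) (z ∷ u)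
stepInto-cons z (inside u⋖w) = inside (there u⋖w)
stepInto-cons z (fromLeft pre x post eq len a<x) = fromLeft (z ∷ pre) x post (cong (z ∷_) eq) (cong suc len) a<x
stepInto-cons z (fromRight pre x post eq len x<a) = fromRight (z ∷ pre) x post (cong (z ∷_) eq) (cong suc len) x<a

stepInto : ∀ {u} p a w → p ≤ length w → u ⋖ insertAt p a w → StepInto a p w u
stepInto zero a [] _ (there ())
stepInto zero a (x ∷ r) _ (here x<a) = fromRight [] x r refl refl x<a
stepInto zero a (x ∷ r) _ (there u⋖w) = inside u⋖w
stepInto (suc zero) a (z ∷ w) _ (here a<z) = fromLeft [] z w refl refl a<z
stepInto (suc zero) a (z ∷ w) (s≤s 0≤|w|) (there u⋖) = stepInto-cons z (stepInto zero a w 0≤|w| u⋖)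
stepInto (suc (suc p)) a (z ∷ []) (s≤s ()) _
stepInto (suc (suc p)) a (z ∷ z' ∷ w) _ (here z'<z) = inside (here z'<z)
stepInto (suc (suc p)) a (z ∷ z' ∷ w) (s≤s p+1≤) (there u⋖) = stepInto-cons z (stepInto (suc p) a (z' ∷ w) p+1≤ u⋖)

entry-in-prefix : ∀ pre (x : ℕ) post S B → pre ++ x ∷ post ≡ S ++ B → length pre < length S → x ∈ S
entry-in-prefix [] x post (y ∷ S) B refl _ = here refl
entry-in-prefix (z ∷ pre) x post (y ∷ S) B eq (s≤s |pre|<|S|) =
  there (entry-in-prefix pre x post S B (proj₂ (∷-injective eq)) |pre|<|S|)

entry-in-suffix : ∀ pre (x : ℕ) post S B → pre ++ x ∷ post ≡ S ++ B → length S ≤ length pre → x ∈ B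
entry-in-suffix pre x post [] B eq _ = subst (x ∈_) eq (∈-++⁺ʳ pre (here refl))
entry-in-suffix (z ∷ pre) x post (y ∷ S) B eq (s≤s |S|≤|pre|) =
  entry-in-suffix pre x post S B (proj₂ (∷-injective eq)) |S|≤|pre|

-- The interval is closed downwards: a step below a member, w.r.t. the weak
-- order, is again a member.  231-avoidance excludes the steps that would
-- move a out of the allowed range of positions.
closedDown : ∀ {π u v} → Avoids231ˡ π → u ⋖ v → v ∈ interval π → u ∈ interval π
closedDown [] () (here refl)
closedDown {a ∷ _} (split {S} {B} S<a a<B ∷ av) u⋖v v∈ with interval-∈⁻ a (S ++ B) v∈
... | inserted p w∈ p<c with lowPrefix-interval S B S<a (All.map <⇒≯ a<B) w∈
... | lowPrefix {S'} {B'} |S'|≡|S| S'<a B'≮a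
  with stepInto p a (S' ++ B') (≤-trans (insertPosition-≤ S' S<a a<B |S'|≡|S| p<c) (length-++-≤ˡ S')) u⋖v
... | inside u'⋖w = interval-∈⁺ a (S ++ B) (closedDown av u'⋖w w∈) p<c
... | fromLeft pre x post eq |pre|+1≡p a<x =
  contradiction a<x (<⇒≯ (All.lookup S'<a (entry-in-prefix pre x post S' B' (sym eq) |pre|<|S'|)))
  where
  |pre|<|S'| : length pre < length S'
  |pre|<|S'| = subst (_≤ length S') (sym |pre|+1≡p) (insertPosition-≤ S' S<a a<B |S'|≡|S| p<c)
... | fromRight pre x post eq |pre|≡p x<a with length S' ≤? p
...   | yes |S'|≤p = contradiction x<a
          (All.lookup B'≮a (entry-in-suffix pre x post S' B' (sym eq) (subst (length S' ≤_) (sym |pre|≡p) |S'|≤p)))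
...   | no |S'|≰p = interval-∈⁺ a (S ++ B) w∈ (subst (suc p <_) (sym c≡) (s≤s (≰⇒> |S'|≰p)))
  where
  c≡ : nextGreater a (S ++ B) ≡ suc (length S')
  c≡ = trans (nextGreater-split a S B S<a a<B) (cong suc (sym |S'|≡|S|))

interval-downSet : ∀ {π u v} → Avoids231ˡ π → u ≼ v → v ∈ interval π → u ∈ interval π
interval-downSet av ε v∈ = v∈
interval-downSet av (u⋖ ◅ ≼v) v∈ = closedDown av u⋖ (interval-downSet av ≼v v∈)

AllPairs-remove : ∀ {A : Set} {R : A → A → Set} ys x zs → AllPairs R (ys ++ x ∷ zs) →
  All (λ y → R y x) ys × All (R x) zs × AllPairs R (ys ++ zs)
AllPairs-remove [] x zs (x-R ∷ ps) = [] , x-R , ps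
AllPairs-remove (y ∷ ys) x zs (y-R ∷ ps) with AllPairs-remove ys x zs ps | All.++⁻ ys y-R
... | ys-R-x , x-R-zs , ps' | y-R-ys , (y-R-x ∷ y-R-zs) = (y-R-x ∷ ys-R-x) , x-R-zs , (All.++⁺ y-R-ys y-R-zs ∷ ps')

-- Any rearrangement w of an increasing list s lies above s in the weak
-- order: the first entry of w is raised to the front, the rest by recursion.
reachedFromSorted : ∀ w {s} → AllPairs _<_ s → w ↭ s → s ≼ w
reachedFromSorted [] {[]} _ _ = ε
reachedFromSorted [] {_ ∷ _} _ w↭s with ↭-length w↭s
... | ()
reachedFromSorted (x ∷ w) inc w↭s with ∈-∃++ (∈-resp-↭ w↭s (here refl))
... | ys , zs , refl with AllPairs-remove ys x zs inc
... | ys<x , _ , inc' = subst (_≼ (x ∷ w)) (insertAt-end x ys zs)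
  (raiseToFront x (length ys) ys zs ys<x ≤-refl ◅◅ ≼-cons x (reachedFromSorted w inc' (drop-mid [] ys w↭s)))

map-unique-on : ∀ {A B : Set} (f : A → B) {xs} → Unique xs →
  (∀ {x y} → x ∈ xs → y ∈ xs → f x ≡ f y → x ≡ y) → Unique (map f xs)
map-unique-on f {[]} [] _ = []
map-unique-on f {x ∷ xs} (x∉xs ∷ u) inj =
  All.tabulate (λ fy∈ fx≡ → let (y , y∈ , fy≡) = ∈-map⁻ f fy∈ in
                 All.lookup x∉xs y∈ (inj (here refl) (there y∈) (trans fx≡ fy≡)))
  ∷ map-unique-on f u (λ x∈ y∈ → inj (there x∈) (there y∈))

productMap-unique : ∀ {A B C : Set} (f : A → B → C) {W D} → Unique W → Unique D →
  (∀ {x x' d d'} → x ∈ W → x' ∈ W → d ∈ D → d' ∈ D → f x d ≡ f x' d' → x ≡ x' × d ≡ d') →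
  Unique (concatMap (λ x → map (f x) D) W)
productMap-unique f {[]} [] uD inj = []
productMap-unique f {x ∷ W} {D} (x∉W ∷ uW) uD inj =
  Unique.++⁺ (map-unique-on (f x) uD λ d∈ d'∈ eq → proj₂ (inj (here refl) (here refl) d∈ d'∈ eq))
             (productMap-unique f uW uD λ x∈ x'∈ → inj (there x∈) (there x'∈))
             disjoint
  where
  disjoint : ∀ {v} → ¬ (v ∈ map (f x) D × v ∈ concatMap (λ x → map (f x) D) W)
  disjoint (v∈₁ , v∈₂) with ∈-map⁻ (f x) v∈₁ | find (∈-concatMap⁻ (λ x → map (f x) D) {xs = W} v∈₂)
  ... | d , d∈ , refl | x' , x'∈ , v∈₃ with ∈-map⁻ (f x') v∈₃
  ... | d' , d'∈ , eq = All.lookup x∉W x'∈ (proj₁ (inj (here refl) (there x'∈) d∈ d'∈ eq))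

interval-unique : ∀ l → Unique l → Unique (interval l)
interval-unique [] _ = [] ∷ []
interval-unique (a ∷ l) (a∉l ∷ ul) =
  productMap-unique (λ w d → insertAt (c ∸ suc d) a w) (interval-unique l ul) (Unique.downFrom⁺ c) injective
  where
  c : ℕ
  c = nextGreater a l
  a∉ : ∀ {w} → w ∈ interval l → a ∉ w
  a∉ w∈ a∈w = All.lookup a∉l (∈-resp-↭ (interval-↭ l w∈) a∈w) refl
  position-≤ : ∀ {w} d → w ∈ interval l → c ∸ suc d ≤ length w
  position-≤ d w∈ = subst (c ∸ suc d ≤_) (sym (↭-length (interval-↭ l w∈)))
    (≤-trans (∸-monoʳ-≤ c (s≤s (z≤n {d}))) (∸-monoˡ-≤ 1 (nextGreater-≤ a l)))
  injective : ∀ {w w' d d'} → w ∈ interval l → w' ∈ interval l → d ∈ downFrom c → d' ∈ downFrom c →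
    insertAt (c ∸ suc d) a w ≡ insertAt (c ∸ suc d') a w' → w ≡ w' × d ≡ d'
  injective {d = d} {d'} w∈ w'∈ d∈ d'∈ eq
    with insertAt-injective a _ _ _ _ (a∉ w∈) (a∉ w'∈) (position-≤ d w∈) (position-≤ d' w'∈) eq
  ... | p≡p' , refl = refl , (begin
    d                         ≡⟨ sym (∸-suc-involutive (∈-downFrom⁻ d∈)) ⟩
    c ∸ suc (c ∸ suc d)       ≡⟨ cong (λ p → c ∸ suc p) p≡p' ⟩
    c ∸ suc (c ∸ suc d')      ≡⟨ ∸-suc-involutive (∈-downFrom⁻ d'∈) ⟩
    d'                        ∎)
    where open ≡-Reasoning

inversions-insertion : ∀ {a m w} d → LowPrefix a m w → d ≤ m →
  inversions (insertAt (m ∸ d) a w) ≡ d + inversions w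
inversions-insertion {a} d (lowPrefix {S} {B} refl S<a B≮a) d≤m =
  trans (inversions-insertAt a (length S ∸ d) S B S<a (m∸n≤m (length S) d) B≮a)
        (cong (_+ inversions (S ++ B)) (m∸[m∸n]≡n d≤m))

interval-weightPoly : ∀ {l} → Avoids231ˡ l → ∀ k → weightPoly inversions (interval l) k ≡ prodQInt (cList l) k
interval-weightPoly [] zero = refl
interval-weightPoly [] (suc k) = refl
interval-weightPoly {a ∷ _} (split {S} {B} S<a a<B ∷ av) k = begin
  weightPoly inversions (interval (a ∷ S ++ B)) k
    ≡⟨ weightPoly-concatMap inversions inversions (insertions c a) (qint c) (interval (S ++ B)) insertions-weightPoly k ⟩
  (qint c ⊛ weightPoly inversions (interval (S ++ B))) k
    ≡⟨ ⊛-congʳ (qint c) _ _ (interval-weightPoly av) k ⟩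
  (qint c ⊛ prodQInt (cList (S ++ B))) k ∎
  where
  open ≡-Reasoning
  c : ℕ
  c = nextGreater a (S ++ B)
  c≡ : c ≡ suc (length S)
  c≡ = nextGreater-split a S B S<a a<B
  insertions-weightPoly : ∀ {w} → w ∈ interval (S ++ B) →
    ∀ k → weightPoly inversions (insertions c a w) k ≡ (qint c ⊛ monomial (inversions w)) k
  insertions-weightPoly {w} w∈ k = begin
    count (λ v → inversions v ≡ᵇ k) (insertions c a w)
      ≡⟨ count-map (λ v → inversions v ≡ᵇ k) (λ d → insertAt (c ∸ suc d) a w) (downFrom c) ⟩
    count (λ d → inversions (insertAt (c ∸ suc d) a w) ≡ᵇ k) (downFrom c)
      ≡⟨ count-cong _ _ (All.tabulate λ {d} d∈ → cong (_≡ᵇ k) (trans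
           (cong (λ p → inversions (insertAt (p ∸ suc d) a w)) c≡)
           (inversions-insertion d (lowPrefix-interval S B S<a (All.map <⇒≯ a<B) w∈)
                                   (≤-pred (subst (d <_) c≡ (∈-downFrom⁻ d∈)))))) ⟩
    count (λ d → (d + inversions w) ≡ᵇ k) (downFrom c)
      ≡⟨ qint-shift c (inversions w) k ⟩
    (qint c ⊛ monomial (inversions w)) k ∎

entries : ∀ {m k} → Vec (Fin m) k → List ℕ
entries v = map toℕ (toList v)

length-entries : ∀ {m k} (v : Vec (Fin m) k) → length (entries v) ≡ k
length-entries [] = refl
length-entries (x ∷ v) = cong suc (length-entries v)

entries-bounded : ∀ {m k} (v : Vec (Fin m) k) → All (_< m) (entries v)
entries-bounded [] = []
entries-bounded (x ∷ v) = toℕ<n x ∷ entries-bounded v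

Fits : ℕ → List ℕ → Set
Fits n l = length l ≡ n × All (_< n) l

fits-↭ : ∀ {n l l'} → Fits n l → l ↭ l' → Fits n l'
fits-↭ (len , bounded) l↭l' = trans (sym (↭-length l↭l')) len , All-resp-↭ l↭l' bounded

-- Converting a fitting list back into a vector (the default vector d is
-- only consulted for out-of-range data and fixes the length).
toFin : ∀ {m} → ℕ → Fin m → Fin m
toFin {m} x d with x <? m
... | yes x<m = fromℕ< x<m
... | no _ = d

fromEntries : ∀ {m k} → List ℕ → Vec (Fin m) k → Vec (Fin m) k
fromEntries [] d = d
fromEntries (x ∷ l) [] = []
fromEntries (x ∷ l) (d ∷ ds) = toFin x d ∷ fromEntries l ds

entries-fromEntries : ∀ {m k} l (d : Vec (Fin m) k) → length l ≡ k → All (_< m) l → entries (fromEntries l d) ≡ l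
entries-fromEntries [] [] _ _ = refl
entries-fromEntries {m} (x ∷ l) (d ∷ ds) len (x<m ∷ l<m) =
  cong₂ _∷_ toFin-correct (entries-fromEntries l ds (suc-injective len) l<m)
  where
  toFin-correct : toℕ (toFin x d) ≡ x
  toFin-correct with x <? m
  ... | yes x<m' = toℕ-fromℕ< x<m'
  ... | no x≮m = contradiction x<m x≮m

fromEntries-entries : ∀ {m k} (v d : Vec (Fin m) k) → fromEntries (entries v) d ≡ v
fromEntries-entries [] [] = refl
fromEntries-entries {m} (x ∷ v) (d ∷ ds) = cong₂ _∷_ toFin-toℕ (fromEntries-entries v ds)
  where
  toFin-toℕ : toFin (toℕ x) d ≡ x
  toFin-toℕ with toℕ x <? m
  ... | yes x<m = fromℕ<-toℕ x x<m
  ... | no x≮m = contradiction (toℕ<n x) x≮m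

ΣFin : (k : ℕ) → (Fin k → ℕ) → ℕ
ΣFin zero f = 0
ΣFin (suc k) f = f zero + ΣFin k (λ i → f (suc i))

ΣFin-cong : ∀ k (f g : Fin k → ℕ) → (∀ i → f i ≡ g i) → ΣFin k f ≡ ΣFin k g
ΣFin-cong zero f g f≗g = refl
ΣFin-cong (suc k) f g f≗g = cong₂ _+_ (f≗g zero) (ΣFin-cong k _ _ (λ i → f≗g (suc i)))

count-tabulate : ∀ {B : Set} (p : B → Bool) k (f : Fin k → B) →
  count p (tabulateL f) ≡ ΣFin k (λ j → indicator (p (f j)))
count-tabulate p zero f = refl
count-tabulate p (suc k) f = cong (indicator (p (f zero)) +_) (count-tabulate p k (λ j → f (suc j)))

count-concatMap-tabulate : ∀ {B : Set} (p : B → Bool) {k} (g : Fin k → List B) j (h : Fin j → Fin k) →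
  count p (concatMap g (tabulateL h)) ≡ ΣFin j (λ i → count p (g (h i)))
count-concatMap-tabulate p g zero h = refl
count-concatMap-tabulate p g (suc j) h =
  trans (count-++ p (g (h zero)) _) (cong (count p (g (h zero)) +_) (count-concatMap-tabulate p g j (λ i → h (suc i))))

inversionSum : ∀ {m k} → Vec (Fin m) k → ℕ
inversionSum {k = k} w = ΣFin k (λ i → ΣFin k (λ j →
  indicator ((toℕ i <ᵇ toℕ j) ∧ (toℕ (lookup w j) <ᵇ toℕ (lookup w i)))))

len≡inversionSum : ∀ {n} (w : Word n) → len w ≡ inversionSum w
len≡inversionSum {n} w =
  trans (count-concatMap-tabulate isInv (λ i → map (λ j → (i , j)) (allFinL n)) n (λ i → i))
        (ΣFin-cong n _ _ λ i → trans (cong (count isInv) (map-tabulate {n = n} (λ j → j) (λ j → (i , j))))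
                                     (count-tabulate isInv n (λ j → (i , j))))
  where
  isInv : Fin n × Fin n → Bool
  isInv (i , j) = (toℕ i <ᵇ toℕ j) ∧ (toℕ (lookup w j) <ᵇ toℕ (lookup w i))

count-entries : ∀ {m k} t (w : Vec (Fin m) k) →
  count (_<ᵇ t) (entries w) ≡ ΣFin k (λ j → indicator (toℕ (lookup w j) <ᵇ t))
count-entries t [] = refl
count-entries t (x ∷ w) = cong (indicator (toℕ x <ᵇ t) +_) (count-entries t w)

-- Splitting off the first position: the row i = 0 counts the later entries
-- below a_0, the remaining rows are the double sum of the tail.
inversionSum≡inversions : ∀ {m k} (w : Vec (Fin m) k) → inversionSum w ≡ inversions (entries w)
inversionSum≡inversions [] = refl
inversionSum≡inversions (x ∷ w) = cong₂ _+_ (sym (count-entries (toℕ x) w)) (inversionSum≡inversions w)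

len≡inversions : ∀ {n} (w : Word n) → len w ≡ inversions (entries w)
len≡inversions w = trans (len≡inversionSum w) (inversionSum≡inversions w)

swapAt : ℕ → List ℕ → List ℕ
swapAt zero (x ∷ y ∷ r) = y ∷ x ∷ r
swapAt (suc i) (x ∷ r) = x ∷ swapAt i r
swapAt _ l = l

swapAt-↭ : ∀ i l → swapAt i l ↭ l
swapAt-↭ zero [] = ↭-refl
swapAt-↭ zero (x ∷ []) = ↭-refl
swapAt-↭ zero (x ∷ y ∷ r) = swap y x ↭-refl
swapAt-↭ (suc i) [] = ↭-refl
swapAt-↭ (suc i) (x ∷ r) = prep x (swapAt-↭ i r)

swapAt-⋖ : ∀ i l → inversions l < inversions (swapAt i l) → l ⋖ swapAt i l
swapAt-⋖ zero [] more = contradiction more (n≮n _)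
swapAt-⋖ zero (x ∷ []) more = contradiction more (n≮n _)
swapAt-⋖ zero (x ∷ y ∷ r) more with <-cmp x y
... | tri< x<y _ _ = here x<y
... | tri≈ _ refl _ = contradiction more (n≮n _)
... | tri> _ _ y<x = contradiction more (<⇒≯ (⋖-inversions (here {r = r} y<x)))
swapAt-⋖ (suc i) [] more = contradiction more (n≮n _)
swapAt-⋖ (suc i) (x ∷ r) more rewrite count-↭ (_<ᵇ x) (swapAt-↭ i r) =
  there (swapAt-⋖ i r (+-cancelˡ-< (count (_<ᵇ x) r) _ _ more))

⋖-swapAt : ∀ {l l'} → l ⋖ l' → Σ ℕ λ i → suc i < length l × l' ≡ swapAt i l
⋖-swapAt (here _) = zero , s≤s (s≤s z≤n) , refl
⋖-swapAt (there l⋖l') with ⋖-swapAt l⋖l'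
... | i , i+1<len , refl = suc i , s≤s i+1<len , refl

nth : List ℕ → ℕ → ℕ
nth [] _ = 0
nth (x ∷ l) zero = x
nth (x ∷ l) (suc k) = nth l k

nth-ext : ∀ n l l' → length l ≡ n → length l' ≡ n →
  (∀ (q : Fin n) → nth l (toℕ q) ≡ nth l' (toℕ q)) → l ≡ l'
nth-ext zero [] [] _ _ _ = refl
nth-ext (suc n) (x ∷ l) (y ∷ l') len len' agree =
  cong₂ _∷_ (agree zero) (nth-ext n l l' (suc-injective len) (suc-injective len') (λ q → agree (suc q)))

nth-entries : ∀ {m k} (v : Vec (Fin m) k) q → nth (entries v) (toℕ q) ≡ toℕ (lookup v q)
nth-entries (x ∷ v) zero = refl
nth-entries (x ∷ v) (suc q) = nth-entries v q

nth-swapAt : ∀ i l q → suc i < length l →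
  nth (swapAt i l) q ≡ (if q ≡ᵇ i then nth l (suc i) else if q ≡ᵇ suc i then nth l i else nth l q)
nth-swapAt zero (x ∷ []) q (s≤s ())
nth-swapAt zero (x ∷ y ∷ r) zero _ = refl
nth-swapAt zero (x ∷ y ∷ r) (suc zero) _ = refl
nth-swapAt zero (x ∷ y ∷ r) (suc (suc q)) _ = refl
nth-swapAt (suc i) (x ∷ r) zero _ = refl
nth-swapAt (suc i) (x ∷ r) (suc q) (s≤s i+1<len) = nth-swapAt i r q i+1<len

does-≟ᶠ : ∀ {n} (a b : Fin n) → does (a ≟ᶠ b) ≡ (toℕ a ≡ᵇ toℕ b)
does-≟ᶠ a b with a ≟ᶠ b
... | yes refl = sym (≡ᵇ-true (refl {x = toℕ a}))
... | no a≢b = sym (≡ᵇ-false (λ eq → a≢b (toℕ-injective eq)))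

entries-swapPos : ∀ {n} (u : Word n) (i j : Fin n) → toℕ j ≡ suc (toℕ i) →
  entries (swapPos u i j) ≡ swapAt (toℕ i) (entries u)
entries-swapPos {n} u i j j≡i+1 =
  nth-ext n _ _ (length-entries (swapPos u i j)) (trans (↭-length (swapAt-↭ (toℕ i) (entries u))) (length-entries u)) agree
  where
  i+1<len : suc (toℕ i) < length (entries u)
  i+1<len = subst₂ _<_ j≡i+1 (sym (length-entries u)) (toℕ<n j)
  agree : ∀ q → nth (entries (swapPos u i j)) (toℕ q) ≡ nth (swapAt (toℕ i) (entries u)) (toℕ q)
  agree q rewrite nth-entries (swapPos u i j) q | nth-swapAt (toℕ i) (entries u) (toℕ q) i+1<len
                | lookup∘tabulate (λ k → if does (k ≟ᶠ i) then lookup u j else if does (k ≟ᶠ j) then lookup u i else lookup u k) q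
                | does-≟ᶠ q i | does-≟ᶠ q j with toℕ q ≡ᵇ toℕ i
  ... | true = trans (sym (nth-entries u j)) (cong (nth (entries u)) j≡i+1)
  ... | false rewrite sym j≡i+1 with toℕ q ≡ᵇ toℕ j
  ...   | true = sym (nth-entries u i)
  ...   | false = sym (nth-entries u q)

cover⇒⋖ : ∀ {n} {u v : Word n} → Cover u v → entries u ⋖ entries v
cover⇒⋖ {u = u} (cover i j j≡i+1 longer) rewrite entries-swapPos u i j j≡i+1 =
  swapAt-⋖ (toℕ i) (entries u)
    (subst₂ _<_ (len≡inversions u) (trans (len≡inversions (swapPos u i j)) (cong inversions (entries-swapPos u i j j≡i+1))) longer)

⋖⇒cover : ∀ {n} (d : Word n) {l l'} → Fits n l → l ⋖ l' → Cover (fromEntries l d) (fromEntries l' d)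
⋖⇒cover {n} d {l} fits l⋖l' with ⋖-swapAt l⋖l'
... | i , i+1<len , refl = subst (Cover u) swapped (cover i′ j′ j′≡i′+1 longer)
  where
  u : Word n
  u = fromEntries l d
  entries-u : entries u ≡ l
  entries-u = entries-fromEntries l d (proj₁ fits) (proj₂ fits)
  i+1<n : suc i < n
  i+1<n = subst (suc i <_) (proj₁ fits) i+1<len
  i′ j′ : Fin n
  i′ = fromℕ< (<-trans (n<1+n i) i+1<n)
  j′ = fromℕ< i+1<n
  j′≡i′+1 : toℕ j′ ≡ suc (toℕ i′)
  j′≡i′+1 = trans (toℕ-fromℕ< i+1<n) (cong suc (sym (toℕ-fromℕ< (<-trans (n<1+n i) i+1<n))))
  entries-swapped : entries (swapPos u i′ j′) ≡ swapAt i l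
  entries-swapped = trans (entries-swapPos u i′ j′ j′≡i′+1) (cong₂ swapAt (toℕ-fromℕ< _) entries-u)
  longer : len u < len (swapPos u i′ j′)
  longer = subst₂ _<_ (sym (trans (len≡inversions u) (cong inversions entries-u)))
                      (sym (trans (len≡inversions (swapPos u i′ j′)) (cong inversions entries-swapped)))
                      (⋖-inversions l⋖l')
  swapped : swapPos u i′ j′ ≡ fromEntries (swapAt i l) d
  swapped = trans (sym (fromEntries-entries (swapPos u i′ j′) d)) (cong (λ l' → fromEntries l' d) entries-swapped)

≼⇒≤W : ∀ {n} (d : Word n) {l l'} → Fits n l → l ≼ l' → fromEntries l d ≤W fromEntries l' d
≼⇒≤W d fits ε = ε
≼⇒≤W d fits (l⋖ ◅ ≼l') = ⋖⇒cover d fits l⋖ ◅ ≼⇒≤W d (fits-↭ fits (⋖-↭ l⋖)) ≼l'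

≤W⇒≼ : ∀ {n} {u v : Word n} → u ≤W v → entries u ≼ entries v
≤W⇒≼ ε = ε
≤W⇒≼ (c ◅ cs) = cover⇒⋖ c ◅ ≤W⇒≼ cs

∈-entries : ∀ {m k} (v : Vec (Fin m) k) {z} → z ∈ entries v → Σ (Fin k) λ q → toℕ (lookup v q) ≡ z
∈-entries (x ∷ v) (here refl) = zero , refl
∈-entries (x ∷ v) (there z∈) with ∈-entries v z∈
... | q , eq = suc q , eq

entries-unique : ∀ {m k} (v : Vec (Fin m) k) → Injective _≡_ _≡_ (lookup v) → Unique (entries v)
entries-unique [] _ = []
entries-unique (x ∷ v) inj = All.tabulate head-new ∷ entries-unique v (λ eq → Fin-suc-injective (inj eq))
  where
  head-new : ∀ {z} → z ∈ entries v → toℕ x ≢ z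
  head-new z∈ x≡z with ∈-entries v z∈
  ... | q , eq with inj {zero} {suc q} (toℕ-injective (trans x≡z (sym eq)))
  ... | ()

unique-bounded : ∀ n l → Unique l → All (_< n) l → length l ≤ n × (length l ≡ n → l ↭ upTo n)
unique-bounded zero [] _ _ = z≤n , λ _ → ↭-refl
unique-bounded zero (x ∷ l) _ (() ∷ _)
unique-bounded (suc m) l u l<m+1 with m ∈? l
... | no m∉l = m≤n⇒m≤1+n (proj₁ rest) , λ len≡ → contradiction (subst (_≤ m) len≡ (proj₁ rest)) (n≮n m)
  where
  rest : length l ≤ m × (length l ≡ m → l ↭ upTo m)
  rest = unique-bounded m l u (All.tabulate λ {z} z∈ →
           ≤∧≢⇒< (≤-pred (All.lookup l<m+1 z∈)) (λ z≡m → m∉l (subst (_∈ l) z≡m z∈)))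
... | yes m∈l with ∈-∃++ m∈l
...   | ys , zs , refl with AllPairs-remove ys m zs u
...     | ys≢m , m≢zs , u' = subst (_≤ suc m) (sym len≡) (s≤s (proj₁ rest)) , rearranged
  where
  len≡ : length (ys ++ m ∷ zs) ≡ suc (length (ys ++ zs))
  len≡ = ↭-length (shift m ys zs)
  below-m : ∀ {z} → z ∈ ys ++ zs → z < m
  below-m {z} z∈ with ∈-++⁻ ys z∈
  ... | inj₁ z∈ys = ≤∧≢⇒< (≤-pred (All.lookup l<m+1 (∈-++⁺ˡ z∈ys))) (All.lookup ys≢m z∈ys)
  ... | inj₂ z∈zs = ≤∧≢⇒< (≤-pred (All.lookup l<m+1 (∈-++⁺ʳ ys (there z∈zs)))) (≢-sym (All.lookup m≢zs z∈zs))
  rest : length (ys ++ zs) ≤ m × (length (ys ++ zs) ≡ m → ys ++ zs ↭ upTo m)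
  rest = unique-bounded m (ys ++ zs) u' (All.tabulate below-m)
  rearranged : length (ys ++ m ∷ zs) ≡ suc m → ys ++ m ∷ zs ↭ upTo (suc m)
  rearranged len≡m+1 =
    ↭-trans (shift m ys zs) (↭-trans (prep m (proj₂ rest (suc-injective (trans (sym len≡) len≡m+1))))
      (subst (m ∷ upTo m ↭_) (upTo-∷ʳ m) (++-comm (m ∷ []) (upTo m))))

entries-tabulate : ∀ {m n} (f : Fin n → Fin m) (g : ℕ → ℕ) → (∀ i → toℕ (f i) ≡ g (toℕ i)) →
  entries (tabulate f) ≡ applyUpTo g n
entries-tabulate {n = zero} f g f≗g = refl
entries-tabulate {n = suc n} f g f≗g =
  cong₂ _∷_ (f≗g zero) (entries-tabulate (λ i → f (suc i)) (λ i → g (suc i)) (λ i → f≗g (suc i)))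

entries-id : ∀ n → entries (idPerm n) ≡ upTo n
entries-id n = entries-tabulate (λ i → i) (λ i → i) (λ _ → refl)

upTo-increasing : ∀ n → AllPairs _<_ (upTo n)
upTo-increasing n = applyUpTo⁺₁ (λ i → i) n (λ i<j _ → i<j)

Avoids231ᵛ : ∀ {m k} → Vec (Fin m) k → Set
Avoids231ᵛ {k = k} w = (i j l : Fin k) → i <ᶠ j → j <ᶠ l →
  ¬ ((lookup w l <ᶠ lookup w i) × (lookup w i <ᶠ lookup w j))

data Precedes : List ℕ → ℕ → ℕ → Set where
  first : ∀ {y z l} → z ∈ l → Precedes (y ∷ l) y z
  later : ∀ {x y z l} → Precedes l y z → Precedes (x ∷ l) y z

precedes-entries : ∀ {m k} (w : Vec (Fin m) k) {y z} → Precedes (entries w) y z →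
  Σ (Fin k) λ j → Σ (Fin k) λ l → (j <ᶠ l) × (toℕ (lookup w j) ≡ y) × (toℕ (lookup w l) ≡ z)
precedes-entries (x ∷ w) (first z∈) with ∈-entries w z∈
... | q , eq = zero , suc q , s≤s z≤n , refl , eq
precedes-entries (x ∷ w) (later y≺z) with precedes-entries w y≺z
... | j , l , j<l , eq₁ , eq₂ = suc j , suc l , s≤s j<l , eq₁ , eq₂

splitAt-no-231 : ∀ a l → a ∉ l → (∀ {y z} → Precedes l y z → ¬ (z < a × a < y)) → SplitAt a l
splitAt-no-231 a [] _ _ = split {S = []} {B = []} [] []
splitAt-no-231 a (y ∷ l) a∉ no-231 with <-cmp y a
... | tri≈ _ y≡a _ = contradiction (here (sym y≡a)) a∉
... | tri> _ _ a<y = split {S = []} [] (a<y ∷ All.tabulate a<later)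
  where
  a<later : ∀ {z} → z ∈ l → a < z
  a<later {z} z∈ = ≤∧≢⇒< (≮⇒≥ (λ z<a → no-231 (first z∈) (z<a , a<y)))
                         (λ a≡z → a∉ (there (subst (_∈ l) (sym a≡z) z∈)))
... | tri< y<a _ _ with splitAt-no-231 a l (λ a∈ → a∉ (there a∈)) (λ y≺z → no-231 (later y≺z))
...   | split S<a a<B = split (y<a ∷ S<a) a<B

entries-avoids231 : ∀ {m k} (v : Vec (Fin m) k) → Injective _≡_ _≡_ (lookup v) → Avoids231ᵛ v →
  Avoids231ˡ (entries v)
entries-avoids231 [] _ _ = []
entries-avoids231 (x ∷ v) inj av with entries-unique (x ∷ v) inj
... | x-new ∷ _ = splitAt-no-231 (toℕ x) (entries v) (λ x∈ → All.lookup x-new x∈ refl) no-231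
                ∷ entries-avoids231 v (λ eq → Fin-suc-injective (inj eq))
                                      (λ i j l i<j j<l → av (suc i) (suc j) (suc l) (s≤s i<j) (s≤s j<l))
  where
  no-231 : ∀ {y z} → Precedes (entries v) y z → ¬ (z < toℕ x × toℕ x < y)
  no-231 y≺z z<x<y with precedes-entries v y≺z
  ... | j , l , j<l , refl , refl = av zero (suc j) (suc l) (s≤s z≤n) (s≤s j<l) z<x<y

entries-≼⇒≤W : ∀ {n} (u v : Word n) → entries u ≼ entries v → u ≤W v
entries-≼⇒≤W u v eu≼ev =
  subst₂ _≤W_ (fromEntries-entries u u) (fromEntries-entries v u)
    (≼⇒≤W u (length-entries u , entries-bounded u) eu≼ev)

intervalWords : ∀ {n} → Word n → List (Word n)
intervalWords π = map (λ l → fromEntries l π) (interval (entries π))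

module _ {n} (π : Word n) where

  toWord : List ℕ → Word n
  toWord l = fromEntries l π

  entries-toWord : ∀ {w} → w ∈ interval (entries π) → entries (toWord w) ≡ w
  entries-toWord {w} w∈ = entries-fromEntries _ π (proj₁ fits) (proj₂ fits)
    where
    fits : Fits n w
    fits = fits-↭ (length-entries π , entries-bounded π) (↭-sym (interval-↭ (entries π) w∈))

  intervalWords-unique : IsPerm π → Unique (intervalWords π)
  intervalWords-unique inj =
    map-unique-on toWord (interval-unique (entries π) (entries-unique π inj))
      (λ w∈ w'∈ eq → trans (sym (entries-toWord w∈)) (trans (cong entries eq) (entries-toWord w'∈)))

  -- Membership: the list interval is a down-set containing entries π, and
  -- its members lie above the sorted list 0, …, n−1 = entries id.
  intervalWords-∈⇔ : IsPerm π → Avoids231 π → ∀ u → u ∈ intervalWords π ⇔ InInterval π u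
  intervalWords-∈⇔ inj av u = mk⇔ member⇒interval interval⇒member
    where
    P : List ℕ
    P = entries π
    P-avoids : Avoids231ˡ P
    P-avoids = entries-avoids231 π inj av
    P↭id : P ↭ entries (idPerm n)
    P↭id = subst (P ↭_) (sym (entries-id n))
             (proj₂ (unique-bounded n P (entries-unique π inj) (entries-bounded π)) (length-entries π))
    member⇒interval : u ∈ intervalWords π → InInterval π u
    member⇒interval u∈ with ∈-map⁻ toWord u∈
    ... | w , w∈ , refl =
      entries-≼⇒≤W (idPerm n) (toWord w)
        (subst (entries (idPerm n) ≼_) (sym (entries-toWord w∈))
          (reachedFromSorted w (subst (AllPairs _<_) (sym (entries-id n)) (upTo-increasing n))
                                (↭-trans (interval-↭ P w∈) P↭id))) ,
      entries-≼⇒≤W (toWord w) π (subst (_≼ P) (sym (entries-toWord w∈)) (reachesTop P-avoids w∈))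
    interval⇒member : InInterval π u → u ∈ intervalWords π
    interval⇒member (_ , u≤π) = subst (_∈ intervalWords π) (fromEntries-entries u π)
      (∈-map⁺ toWord (interval-downSet P-avoids (≤W⇒≼ u≤π) (interval-self P)))

  -- Lengths of words are inversion numbers of their entries.
  intervalWords-genPoly : IsPerm π → Avoids231 π → ∀ k → genPoly (intervalWords π) k ≡ prodQInt (cs π) k
  intervalWords-genPoly inj av k = begin
    count (λ u → len u ≡ᵇ k) (map toWord (interval (entries π)))
      ≡⟨ count-map (λ u → len u ≡ᵇ k) toWord (interval (entries π)) ⟩
    count (λ w → len (toWord w) ≡ᵇ k) (interval (entries π))
      ≡⟨ count-cong _ _ (All.tabulate λ {w} w∈ →
           cong (_≡ᵇ k) (trans (len≡inversions (toWord w)) (cong inversions (entries-toWord w∈)))) ⟩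
    weightPoly inversions (interval (entries π)) k
      ≡⟨ interval-weightPoly (entries-avoids231 π inj av) k ⟩
    prodQInt (cs π) k ∎
    where open ≡-Reasoning

corollary3p8 : (n : ℕ) (π : Word n) → IsPerm π → Avoids231 π →
    Σ (List (Word n)) (λ L →
      Unique L × ((u : Word n) → (u ∈ L) ⇔ InInterval π u) ×
      ((k : ℕ) → genPoly L k ≡ prodQInt (cs π) k))
corollary3p8 n π inj av =
  intervalWords π , intervalWords-unique π inj , intervalWords-∈⇔ π inj av , intervalWords-genPoly π inj av
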